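{- Let $L$ be a distributive lattice. Then (i) $\tau_L=\sigma_L$; (ii) the map $b_L:spec(L)\to\mathfrak{M}(L)$, $P\mapsto (P,L\setminus P)$, is a homeomorphism from $spec(L)$ with its Zariski topology onto $(\mathfrak{M}(L),\tau_L)$.
   Context: Ideals and filters are nonempty. $spec(L)$ is the set of prime ideals of $L$, with the Zariski topology, whose basis is $\{d_L(x):x\in L\}$, $d_L(x)=\{P\in spec(L):x\notin P\}$. A comaximal pair of $L$ is $(I,F)$, $I$ an ideal, $F$ a filter, $I\cap F=\emptyset$, such that every ideal $J\supsetneq I$ meets $F$ and every filter $K\supsetneq F$ meets $I$; $\mathfrak{M}(L)$ is the set of comaximal pairs. $\sigma_L$ is the topology on $\mathfrak{M}(L)$ with basis $\{\{(I,F):x\in F\}:x\in L\}$ and $\tau_L$ the topology generated by the subbasis $\{\{(I,F):x\notin I\}:x\in L\}$. -}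

module Defs where

open import Level using (Level; _⊔_; suc; Setω)
open import Data.Product using (Σ; ∃; ∃-syntax; _×_; _,_; proj₁; proj₂)
open import Data.Sum using (_⊎_)
open import Data.Empty using (⊥)
open import Data.List using (List)
open import Data.List.Relation.Unary.All using (All)
open import Relation.Nullary using (¬_)
open import Relation.Unary using (Pred; _∈_; _∉_; _⊆_)
open import Algebra.Lattice.Bundles using (DistributiveLattice)

record _×ω_ (A B : Setω) : Setω where
  constructor _,ω_
  field
    fstω : A
    sndω : B

record Σω {a} (A : Set a) (B : A → Setω) : Setω where
  constructor _,ω_
  field
    fst : A
    snd : B fst

-- Generic point-set topology on a type X with an equivalence _≈X_
-- (topologies are described by the predicate "U is open").

OpenFromBasis : ∀ {x a b u} {X : Set x} {A : Set a} →
                (A → Pred X b) → Pred X u → Set (x ⊔ a ⊔ b ⊔ u)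
OpenFromBasis {A = A} B U = ∀ p → p ∈ U → ∃[ α ] (p ∈ B α × B α ⊆ U)

-- Topology generated by the subbasis S (indexed by A): basic opens are the
-- finite intersections of subbasic sets (the empty intersection being X).
FinInter : ∀ {x a b} {X : Set x} {A : Set a} →
           (A → Pred X b) → List A → Pred X (a ⊔ b)
FinInter S αs p = All (λ α → p ∈ S α) αs

OpenFromSubbasis : ∀ {x a b u} {X : Set x} {A : Set a} →
                   (A → Pred X b) → Pred X u → Set (x ⊔ a ⊔ b ⊔ u)
OpenFromSubbasis {A = A} S U =
  ∀ p → p ∈ U → ∃[ αs ] (p ∈ FinInter S αs × FinInter S αs ⊆ U)

record IsHomeomorphism {x y ex ey : Level} {X : Set x} {Y : Set y}
       (_≈X_ : X → X → Set ex) (_≈Y_ : Y → Y → Set ey)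
       (OX : ∀ {u} → Pred X u → Set (x ⊔ u))
       (OY : ∀ {u} → Pred Y u → Set (y ⊔ u))
       (f : X → Y) : Setω where
  field
    injective  : ∀ p q → f p ≈Y f q → p ≈X q
    surjective : ∀ m → ∃[ p ] (f p ≈Y m)
    continuous : ∀ {u} (U : Pred Y u) → OY U → OX (λ p → f p ∈ U)
    openMap    : ∀ {u} (U : Pred X u) → OX U →
                 OY (λ m → ∃[ p ] (p ∈ U × f p ≈Y m))

module Lat {c ℓ} (L : DistributiveLattice c ℓ) where
  open DistributiveLattice L

  ι : Level
  ι = c ⊔ ℓ

  Subset : Set (suc ι)
  Subset = Pred Carrier ι

  _≤_ : Carrier → Carrier → Set ℓ
  a ≤ b = (a ∧ b) ≈ a

  ∁ : Subset → Subset
  ∁ S = λ a → ¬ (a ∈ S)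

  _≐_ : Subset → Subset → Set ι
  S ≐ T = S ⊆ T × T ⊆ S

  record IsIdeal (I : Subset) : Set ι where
    field
      nonempty : ∃[ a ] (a ∈ I)
      downward : ∀ {a b} → b ≤ a → a ∈ I → b ∈ I
      joins    : ∀ {a b} → a ∈ I → b ∈ I → (a ∨ b) ∈ I

  record IsFilter (F : Subset) : Set ι where
    field
      nonempty : ∃[ a ] (a ∈ F)
      upward   : ∀ {a b} → a ≤ b → a ∈ F → b ∈ F
      meets    : ∀ {a b} → a ∈ F → b ∈ F → (a ∧ b) ∈ F

  record IsPrimeIdeal (P : Subset) : Set ι where
    field
      ideal  : IsIdeal P
      proper : ∃[ a ] (a ∉ P)
      prime  : ∀ {a b} → (a ∧ b) ∈ P → a ∈ P ⊎ b ∈ P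

  Spec : Set (suc ι)
  Spec = Σ Subset IsPrimeIdeal

  _≈Spec_ : Spec → Spec → Set ι
  P ≈Spec Q = proj₁ P ≐ proj₁ Q

  Meets : Subset → Subset → Set ι
  Meets S T = ∃[ a ] (a ∈ S × a ∈ T)

  _⊋_ : Subset → Subset → Set ι
  T ⊋ S = S ⊆ T × ∃[ a ] (a ∈ T × a ∉ S)

  record IsComaximal (I F : Subset) : Set (suc ι) where
    field
      ideal     : IsIdeal I
      filter    : IsFilter F
      disjoint  : ∀ a → a ∈ I → a ∈ F → ⊥
      maxIdeal  : ∀ J → IsIdeal J → J ⊋ I → Meets J F
      maxFilter : ∀ K → IsFilter K → K ⊋ F → Meets K I

  𝔐 : Set (suc ι)
  𝔐 = Σ (Subset × Subset) (λ IF → IsComaximal (proj₁ IF) (proj₂ IF))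

  idl flt : 𝔐 → Subset
  idl m = proj₁ (proj₁ m)
  flt m = proj₂ (proj₁ m)

  _≈𝔐_ : 𝔐 → 𝔐 → Set ι
  m ≈𝔐 n = idl m ≐ idl n × flt m ≐ flt n

  d : Carrier → Pred Spec ι
  d a P = a ∉ proj₁ P

  Zariski : ∀ {u} → Pred Spec u → Set (suc ι ⊔ u)
  Zariski = OpenFromBasis d

  σ-basic : Carrier → Pred 𝔐 ι
  σ-basic a m = a ∈ flt m

  σ : ∀ {u} → Pred 𝔐 u → Set (suc ι ⊔ u)
  σ = OpenFromBasis σ-basic

  τ-subbasic : Carrier → Pred 𝔐 ι
  τ-subbasic a m = a ∉ idl m

  τ : ∀ {u} → Pred 𝔐 u → Set (suc ι ⊔ u)
  τ = OpenFromSubbasis τ-subbasic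

  b : (∀ (P : Spec) → IsComaximal (proj₁ P) (∁ (proj₁ P))) → Spec → 𝔐
  b h P = (proj₁ P , ∁ (proj₁ P)) , h P

{-# OPTIONS --safe #-}

-- In a comaximal pair (I , F), adjoining any a ∉ I to I yields an ideal meeting F.
-- If a , b ∉ I but a ∧ b ∈ I, two such witnesses f ≤ i ∨ a and g ≤ j ∨ b have
-- f ∧ g ≤ (i ∨ j) ∨ (a ∧ b) ∈ I by distributivity, while f ∧ g ∈ F; so I is
-- prime. Maximality of F against the filter L ∖ I then forces F = L ∖ I. Hence
-- comaximal pairs are exactly the pairs (P , L ∖ P), the subbasic set x ∉ I of
-- τ is the basic set x ∈ F of σ, a finite intersection of these is again basic
-- because filters are closed under meets, and b pulls x ∈ F back to d(x).

module Submission where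

open import Defs
open import Level using (Level; _⊔_)
open import Data.Product using (∃-syntax; _×_; _,_; proj₁; proj₂)
open import Data.Sum using (_⊎_; inj₁; inj₂; [_,_]′)
open import Data.Empty using (⊥-elim)
open import Data.List using ([]; _∷_; foldr)
open import Data.List.Relation.Unary.All as All using (All; []; _∷_)
open import Relation.Nullary using (yes; no)
open import Relation.Unary using (Pred; _∈_; _∉_; _⊆_)
open import Function.Base using (id)
open import Function.Bundles using (_⇔_; mk⇔)
open import Axiom.ExcludedMiddle using (ExcludedMiddle)
open import Axiom.DoubleNegationElimination using (em⇒dne)
open import Algebra.Lattice.Bundles using (DistributiveLattice)
import Algebra.Lattice.Properties.Lattice as LatticeProperties
import Relation.Binary.Lattice as Ord
import Relation.Binary.Lattice.Properties.JoinSemilattice as JoinProperties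
import Relation.Binary.Lattice.Properties.MeetSemilattice as MeetProperties
import Relation.Binary.Reasoning.PartialOrder as ≤-Reasoning

module _ {c ℓ} (L : DistributiveLattice c ℓ) where
  open DistributiveLattice L
  open Lat L hiding (_≤_)
  open LatticeProperties lattice using (∨-∧-orderTheoreticLattice)
  open Ord.Lattice ∨-∧-orderTheoreticLattice
    using (_≤_; poset; joinSemilattice; meetSemilattice; x≤x∨y; y≤x∨y; ∨-least; x∧y≤x; x∧y≤y)
    renaming (refl to ≤-refl; trans to ≤-trans)
  open JoinProperties joinSemilattice using (∨-monotonic)
  open MeetProperties meetSemilattice using (∧-monotonic)

  -- Defs orders L by  a ∧ b ≈ a , the standard library by  a ≈ a ∧ b.
  ideal-downward : ∀ {I a b} → IsIdeal I → b ≤ a → a ∈ I → b ∈ I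
  ideal-downward I b≤a = IsIdeal.downward I (sym b≤a)

  filter-upward : ∀ {F a b} → IsFilter F → a ≤ b → a ∈ F → b ∈ F
  filter-upward F a≤b = IsFilter.upward F (sym a≤b)

  ∨-∧-≤-∨-join : ∀ i a j b → (i ∨ a) ∧ (j ∨ b) ≤ (i ∨ j) ∨ (a ∧ b)
  ∨-∧-≤-∨-join i a j b = begin
    (i ∨ a) ∧ (j ∨ b)               ≤⟨ ∧-monotonic (∨-monotonic (x≤x∨y i j) ≤-refl)
                                                   (∨-monotonic (y≤x∨y i j) ≤-refl) ⟩
    ((i ∨ j) ∨ a) ∧ ((i ∨ j) ∨ b)   ≈⟨ sym (∨-distribˡ-∧ (i ∨ j) a b) ⟩
    (i ∨ j) ∨ (a ∧ b)               ∎
    where open ≤-Reasoning poset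

  foldr-∧-lowerBound : ∀ a₀ xs → All (foldr _∧_ a₀ xs ≤_) xs
  foldr-∧-lowerBound a₀ []       = []
  foldr-∧-lowerBound a₀ (x ∷ xs) =
    x∧y≤x _ _ ∷ All.map (≤-trans (x∧y≤y _ _)) (foldr-∧-lowerBound a₀ xs)

  filter-foldr-∧ : ∀ {F} → IsFilter F → ∀ {a₀ xs} → a₀ ∈ F → All (_∈ F) xs → foldr _∧_ a₀ xs ∈ F
  filter-foldr-∧ F a₀∈F []           = a₀∈F
  filter-foldr-∧ F a₀∈F (x∈F ∷ xs∈F) = IsFilter.meets F x∈F (filter-foldr-∧ F a₀∈F xs∈F)

  ∁-isFilter : ∀ {P} → IsPrimeIdeal P → IsFilter (∁ P)
  ∁-isFilter P = record
    { nonempty = IsPrimeIdeal.proper P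
    ; upward   = λ a≤b a∉P b∈P → a∉P (IsIdeal.downward (IsPrimeIdeal.ideal P) a≤b b∈P)
    ; meets    = λ a∉P b∉P ab∈P → [ a∉P , b∉P ]′ (IsPrimeIdeal.prime P ab∈P)
    }

  module Classical (em : ExcludedMiddle (c ⊔ ℓ)) where

    module Comaximal {I F} (IF : IsComaximal I F) where
      open IsComaximal IF

      adjoin : Carrier → Subset
      adjoin a x = ∃[ i ] (i ∈ I × x ≤ i ∨ a)

      adjoin-isIdeal : ∀ a → IsIdeal (adjoin a)
      adjoin-isIdeal a = record
        { nonempty = a , i₀ , i₀∈I , y≤x∨y i₀ a
        ; downward = λ { y≤x (i , i∈I , x≤i∨a) → i , i∈I , ≤-trans (sym y≤x) x≤i∨a }
        ; joins    = λ { (i , i∈I , x≤i∨a) (j , j∈I , y≤j∨a) →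
            i ∨ j , IsIdeal.joins ideal i∈I j∈I ,
            ∨-least (≤-trans x≤i∨a (∨-monotonic (x≤x∨y i j) ≤-refl))
                    (≤-trans y≤j∨a (∨-monotonic (y≤x∨y i j) ≤-refl)) }
        }
        where
        i₀ = proj₁ (IsIdeal.nonempty ideal)
        i₀∈I = proj₂ (IsIdeal.nonempty ideal)

      adjoin-⊋ : ∀ {a} → a ∉ I → adjoin a ⊋ I
      adjoin-⊋ {a} a∉I =
        (λ {i} i∈I → i , i∈I , x≤x∨y i a) ,
        a , proj₂ (IsIdeal.nonempty (adjoin-isIdeal a)) , a∉I

      adjoin-meets-F : ∀ {a} → a ∉ I → Meets (adjoin a) F
      adjoin-meets-F {a} a∉I = maxIdeal (adjoin a) (adjoin-isIdeal a) (adjoin-⊋ a∉I)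

      adjoin-∧ : ∀ {a b x y} → a ∧ b ∈ I → x ∈ adjoin a → y ∈ adjoin b → x ∧ y ∈ I
      adjoin-∧ {a} {b} ab∈I (i , i∈I , x≤i∨a) (j , j∈I , y≤j∨b) =
        ideal-downward ideal
          (≤-trans (∧-monotonic x≤i∨a y≤j∨b) (∨-∧-≤-∨-join i a j b))
          (IsIdeal.joins ideal (IsIdeal.joins ideal i∈I j∈I) ab∈I)

      isPrimeIdeal : IsPrimeIdeal I
      isPrimeIdeal = record
        { ideal  = ideal
        ; proper = f₀ , λ f₀∈I → disjoint f₀ f₀∈I f₀∈F
        ; prime  = prime
        }
        where
        f₀ = proj₁ (IsFilter.nonempty filter)
        f₀∈F = proj₂ (IsFilter.nonempty filter)

        prime : ∀ {a b} → a ∧ b ∈ I → a ∈ I ⊎ b ∈ I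
        prime {a} {b} ab∈I with em {a ∈ I} | em {b ∈ I}
        ... | yes a∈I | _       = inj₁ a∈I
        ... | no _    | yes b∈I = inj₂ b∈I
        ... | no a∉I  | no b∉I
          with adjoin-meets-F a∉I | adjoin-meets-F b∉I
        ... | x , x∈Ia , x∈F | y , y∈Ib , y∈F =
          ⊥-elim (disjoint (x ∧ y) (adjoin-∧ ab∈I x∈Ia y∈Ib) (IsFilter.meets filter x∈F y∈F))

      ∉I⇒∈F : ∁ I ⊆ F
      ∉I⇒∈F {a} a∉I = em⇒dne em λ a∉F →
        let (x , x∉I , x∈I) = maxFilter (∁ I) (∁-isFilter isPrimeIdeal)
                                ((λ {x} x∈F x∈I → disjoint x x∈I x∈F) , a , a∉I , a∉F)
        in x∉I x∈I

      ∈F⇒∉I : F ⊆ ∁ I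
      ∈F⇒∉I {a} a∈F a∈I = disjoint a a∈I a∈F

    ∁-isComaximal : ∀ (P : Spec) → IsComaximal (proj₁ P) (∁ (proj₁ P))
    ∁-isComaximal (P , isPrime) = record
      { ideal     = IsPrimeIdeal.ideal isPrime
      ; filter    = ∁-isFilter isPrime
      ; disjoint  = λ a a∈P a∉P → a∉P a∈P
      ; maxIdeal  = λ { J _ (_ , a , a∈J , a∉P) → a , a∈J , a∉P }
      ; maxFilter = λ { K _ (_ , a , a∈K , ¬a∉P) → a , a∈K , em⇒dne em ¬a∉P }
      }

    b⁻¹ : 𝔐 → Spec
    b⁻¹ m = idl m , Comaximal.isPrimeIdeal (proj₂ m)

    b-b⁻¹ : ∀ m → b ∁-isComaximal (b⁻¹ m) ≈𝔐 m
    b-b⁻¹ m = (id , id) , (Comaximal.∉I⇒∈F (proj₂ m) , Comaximal.∈F⇒∉I (proj₂ m))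

    τ⇒σ : ∀ {u} (U : Pred 𝔐 u) → τ U → σ U
    τ⇒σ U τU m m∈U with τU m m∈U
    ... | xs , m∈⋂xs , ⋂xs⊆U =
      foldr _∧_ f₀ xs ,
      filter-foldr-∧ (IsComaximal.filter (proj₂ m)) f₀∈F
        (All.map (Comaximal.∉I⇒∈F (proj₂ m)) m∈⋂xs) ,
      λ {n} ⋀xs∈F → ⋂xs⊆U (All.map
        (λ ⋀xs≤x → Comaximal.∈F⇒∉I (proj₂ n)
          (filter-upward (IsComaximal.filter (proj₂ n)) ⋀xs≤x ⋀xs∈F))
        (foldr-∧-lowerBound f₀ xs))
      where
      f₀ = proj₁ (IsFilter.nonempty (IsComaximal.filter (proj₂ m)))
      f₀∈F = proj₂ (IsFilter.nonempty (IsComaximal.filter (proj₂ m)))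

    σ⇒τ : ∀ {u} (U : Pred 𝔐 u) → σ U → τ U
    σ⇒τ U σU m m∈U with σU m m∈U
    ... | x , x∈F , x∈F⊆U =
      x ∷ [] , Comaximal.∈F⇒∉I (proj₂ m) x∈F ∷ [] ,
      λ { {n} (x∉I ∷ []) → x∈F⊆U (Comaximal.∉I⇒∈F (proj₂ n) x∉I) }

    τ⇔σ : ∀ {u} (U : Pred 𝔐 u) → τ U ⇔ σ U
    τ⇔σ U = mk⇔ (τ⇒σ U) (σ⇒τ U)

    b-isHomeomorphism : IsHomeomorphism _≈Spec_ _≈𝔐_ Zariski τ (b ∁-isComaximal)
    b-isHomeomorphism = record
      { injective  = λ P Q bP≈bQ → proj₁ bP≈bQ
      ; surjective = λ m → b⁻¹ m , b-b⁻¹ m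
      ; continuous = continuous
      ; openMap    = openMap
      }
      where
      continuous : ∀ {u} (U : Pred 𝔐 u) → τ U → Zariski (λ P → b ∁-isComaximal P ∈ U)
      continuous U τU P bP∈U =
        let (x , x∉P , x∈F⊆U) = τ⇒σ U τU (b ∁-isComaximal P) bP∈U
        in x , x∉P , x∈F⊆U

      openMap : ∀ {u} (U : Pred Spec u) → Zariski U →
                τ (λ m → ∃[ P ] (P ∈ U × b ∁-isComaximal P ≈𝔐 m))
      openMap U zU = σ⇒τ _ λ { m (P , P∈U , (_ , (∁P⊆F , _))) →
        let (x , x∉P , dx⊆U) = zU P P∈U
        in x , ∁P⊆F x∉P ,
           λ {n} x∈F → b⁻¹ n , dx⊆U (Comaximal.∈F⇒∉I (proj₂ n) x∈F) , b-b⁻¹ n }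

mainTheorem20 : ∀ {c ℓ : Level} → (∀ {a} → ExcludedMiddle a) →
    (L : DistributiveLattice c ℓ) →
    (∀ {u} (U : Pred (Lat.𝔐 L) u) → Lat.τ L U ⇔ Lat.σ L U) ×ω
    Σω (∀ (P : Lat.Spec L) → Lat.IsComaximal L (proj₁ P) (Lat.∁ L (proj₁ P)))
    (λ h → IsHomeomorphism (Lat._≈Spec_ L) (Lat._≈𝔐_ L) (Lat.Zariski L) (Lat.τ L) (Lat.b L h))
mainTheorem20 em L = τ⇔σ ,ω (∁-isComaximal ,ω b-isHomeomorphism)
  where open Classical L em
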